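{- Let $G$ be a finite simple graph, and let $G'$ be obtained from $G$ by adding $k$ edges to $G$. Then $\gamma_{gr}(G)-k\le \gamma_{gr}(G')\le \gamma_{gr}(G)+k$.
   Context: For a vertex $v$ of a graph $G$, $N[v]$ denotes its closed neighborhood. A sequence $S=(v_1,\ldots,v_k)$ of distinct vertices of $G$ is a legal sequence if $N[v_i]\setminus\bigcup_{j=1}^{i-1}N[v_j]\neq\emptyset$ for every $i$. It is a dominating sequence if moreover $\{v_1,\ldots,v_k\}$ is a dominating set of $G$. The Grundy domination number $\gamma_{gr}(G)$ is the maximum length of a legal dominating sequence of $G$. -}

module Defs where

open import Data.Nat using (ℕ; _≤_; _+_)
open import Data.Fin using (Fin; _<_)
open import Data.Bool using (Bool; true; false)
open import Data.List using (List; []; _∷_; _++_; [_]; length)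
open import Data.List.Relation.Unary.All using (All)
open import Data.List.Relation.Unary.Any using (Any)
open import Data.List.Relation.Unary.Unique.Propositional using (Unique)
open import Data.List.Membership.Propositional using (_∈_)
open import Data.Product using (Σ; ∃; _×_; _,_)
open import Data.Sum using (_⊎_)
open import Data.Unit using (⊤)
open import Relation.Binary.PropositionalEquality using (_≡_)
open import Relation.Nullary using (¬_)
open import Function.Bundles using (_⇔_)

record Graph (n : ℕ) : Set where
  field
    adj    : Fin n → Fin n → Bool
    sym    : ∀ i j → adj i j ≡ adj j i
    irrefl : ∀ i → adj i i ≡ false
open Graph public

InN : ∀ {n} → Graph n → Fin n → Fin n → Set
InN G v u = (u ≡ v) ⊎ (adj G v u ≡ true)

LegalFrom : ∀ {n} → Graph n → List (Fin n) → List (Fin n) → Set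
LegalFrom G prev []       = ⊤
LegalFrom G prev (v ∷ vs) =
  (∃ λ u → InN G v u × All (λ w → ¬ InN G w u) prev)
  × LegalFrom G (prev ++ [ v ]) vs

Legal : ∀ {n} → Graph n → List (Fin n) → Set
Legal G S = Unique S × LegalFrom G [] S

Dominating : ∀ {n} → Graph n → List (Fin n) → Set
Dominating G S = ∀ u → Any (λ v → InN G v u) S

LegalDominating : ∀ {n} → Graph n → List (Fin n) → Set
LegalDominating G S = Legal G S × Dominating G S

IsGrundyDom : ∀ {n} → Graph n → ℕ → Set
IsGrundyDom G m =
  (∃ λ S → LegalDominating G S × length S ≡ m)
  × (∀ S → LegalDominating G S → length S ≤ m)

AddsEdges : ∀ {n} → Graph n → Graph n → ℕ → Set
AddsEdges {n} G G' k =
  Σ (List (Fin n × Fin n)) λ es →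
    length es ≡ k
    × Unique es
    × All (λ e → let (i , j) = e in (i < j) × (adj G i j ≡ false)) es
    × (∀ i j → (adj G' i j ≡ true) ⇔ ((adj G i j ≡ true) ⊎ (((i , j) ∈ es) ⊎ ((j , i) ∈ es))))

-- Walk along a longest legal sequence S of one graph and keep a vertex
-- exactly when it still footprints, in the other graph, a vertex not dominated by
-- its predecessors in S.  The kept vertices form a legal sequence of the other
-- graph, which greedily extends to a legal dominating one.  A vertex v of S is
-- dropped only if its old footprint u lost its privacy, i.e. some edge xu with
-- x ∈ {v} ∪ (predecessors of v) was added or removed; such an edge has both ends
-- dominated by v and its predecessors, but u was not dominated before v, so the
-- charged edges are pairwise distinct and at most k vertices are dropped.
module Submission where

open import Defs hiding (sym)
open import Data.Nat using (ℕ; _≤_; _+_; suc; z≤n; s≤s)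
open import Data.Nat.Properties using (+-suc; +-mono-≤; +-monoˡ-≤; ≤-trans; ≤-reflexive)
open import Data.Product using (_×_; ∃; _,_; proj₁; proj₂)
open import Data.Sum using (_⊎_; inj₁; inj₂)
open import Data.Fin using (Fin; _≟_)
open import Data.Fin.Properties using (any?)
open import Data.Bool using (Bool; true; false)
import Data.Bool.Properties as Bool
open import Data.List using (List; []; _∷_; _++_; [_]; length; allFin)
open import Data.List.Properties using (++-assoc; ++-identityʳ; length-removeAt′; length-++-≤ˡ)
open import Data.List.Relation.Unary.All as All using (All; []; _∷_; all?)
open import Data.List.Relation.Unary.Any as Any using (Any; here; there; _─_)
open import Data.List.Relation.Unary.Any.Properties using (++⁺ˡ; ++⁺ʳ)
open import Data.List.Relation.Unary.All.Properties using (¬Any⇒All¬; All¬⇒¬Any)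
open import Data.List.Relation.Unary.AllPairs using ([]; _∷_)
open import Data.List.Relation.Unary.Unique.Propositional using (Unique)
open import Data.List.Membership.Propositional using (_∈_; _∉_; find)
open import Data.List.Membership.Propositional.Properties using (∈-++⁺ˡ; ∈-++⁺ʳ; ∈-++⁻; ∈-allFin)
open import Data.List.Relation.Binary.Subset.Propositional using (_⊆_)
open import Data.Unit using (tt)
open import Data.Empty using (⊥-elim)
open import Relation.Binary.PropositionalEquality using (_≡_; _≢_; refl; sym; trans; subst)
open import Relation.Nullary using (¬_; Dec; yes; no)
open import Relation.Nullary.Decidable using (_⊎-dec_; _×-dec_; ¬?)
open import Function using (_∘_)
open import Function.Bundles using (Equivalence)

∈-─ : ∀ {A : Set} {x y : A} {ys : List A} → y ∈ ys → y ≢ x → (x∈ys : x ∈ ys) → y ∈ (ys ─ x∈ys)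
∈-─ (here refl) y≢x (here refl) = ⊥-elim (y≢x refl)
∈-─ (here refl) y≢x (there _)   = here refl
∈-─ (there y∈ys) y≢x (here refl) = y∈ys
∈-─ (there y∈ys) y≢x (there x∈ys) = there (∈-─ y∈ys y≢x x∈ys)

unique-⊆⇒length-≤ : ∀ {A : Set} {xs ys : List A} → Unique xs → All (_∈ ys) xs → length xs ≤ length ys
unique-⊆⇒length-≤ {xs = []} _ _ = z≤n
unique-⊆⇒length-≤ {xs = x ∷ xs} {ys} (x∉xs ∷ uniq) (x∈ys ∷ xs⊆ys) =
  ≤-trans (s≤s (unique-⊆⇒length-≤ uniq xs⊆ys─x)) (≤-reflexive (sym (length-removeAt′ ys _)))
  where
  xs⊆ys─x : All (_∈ (ys ─ x∈ys)) xs
  xs⊆ys─x = All.zipWith (λ (x≢y , y∈ys) → ∈-─ y∈ys (λ y≡x → x≢y (sym y≡x)) x∈ys) (x∉xs , xs⊆ys)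

module _ {n : ℕ} (G : Graph n) where

  Dominates : List (Fin n) → Fin n → Set
  Dominates S u = Any (λ w → InN G w u) S

  Footprints : List (Fin n) → Fin n → Set
  Footprints prev v = ∃ λ u → InN G v u × All (λ w → ¬ InN G w u) prev

  inN? : ∀ v u → Dec (InN G v u)
  inN? v u = (u ≟ v) ⊎-dec (adj G v u Bool.≟ true)

  dominates? : ∀ S u → Dec (Dominates S u)
  dominates? S u = Any.any? (λ w → inN? w u) S

  footprints? : ∀ prev v → Dec (Footprints prev v)
  footprints? prev v = any? (λ u → inN? v u ×-dec all? (λ w → ¬? (inN? w u)) prev)

  ∈⇒dominates : ∀ {S u} → u ∈ S → Dominates S u
  ∈⇒dominates = Any.map inj₁

  legalFrom⇒fresh×unique : ∀ prev vs → LegalFrom G prev vs → All (_∉ prev) vs × Unique vs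
  legalFrom⇒fresh×unique prev [] _ = [] , []
  legalFrom⇒fresh×unique prev (v ∷ vs) ((u , v∋u , fresh) , legal)
    with legalFrom⇒fresh×unique (prev ++ [ v ]) vs legal
  ... | vs∉prev+v , uniq =
    (λ v∈prev → All.lookup fresh v∈prev v∋u) ∷ All.map (λ ∉ ∈prev → ∉ (∈-++⁺ˡ ∈prev)) vs∉prev+v
    , All.map (λ ∉ w≡v → ∉ (∈-++⁺ʳ prev (here (sym w≡v)))) vs∉prev+v ∷ uniq

  legalFrom-++ : ∀ prev xs {ys} → LegalFrom G prev xs → LegalFrom G (prev ++ xs) ys →
                 LegalFrom G prev (xs ++ ys)
  legalFrom-++ prev []       _             legal-ys = subst (λ p → LegalFrom G p _) (++-identityʳ prev) legal-ys
  legalFrom-++ prev (x ∷ xs) (fp , legal-xs) legal-ys =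
    fp , legalFrom-++ (prev ++ [ x ]) xs legal-xs
           (subst (λ p → LegalFrom G p _) (sym (++-assoc prev [ x ] xs)) legal-ys)

  greedy : List (Fin n) → List (Fin n) → List (Fin n)
  greedy prev [] = []
  greedy prev (x ∷ xs) with dominates? prev x
  ... | yes _ = greedy prev xs
  ... | no  _ = x ∷ greedy (prev ++ [ x ]) xs

  greedy-legal : ∀ prev xs → LegalFrom G prev (greedy prev xs)
  greedy-legal prev [] = tt
  greedy-legal prev (x ∷ xs) with dominates? prev x
  ... | yes _ = greedy-legal prev xs
  ... | no  x-undominated =
    (x , inj₁ refl , ¬Any⇒All¬ prev x-undominated) , greedy-legal (prev ++ [ x ]) xs

  greedy-dominates : ∀ prev xs u → Dominates prev u ⊎ u ∈ xs → Dominates (prev ++ greedy prev xs) u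
  greedy-dominates prev [] u (inj₁ dom) = ++⁺ˡ dom
  greedy-dominates prev (x ∷ xs) u target with dominates? prev x
  greedy-dominates prev (x ∷ xs) u (inj₁ dom)          | yes _     = greedy-dominates prev xs u (inj₁ dom)
  greedy-dominates prev (x ∷ xs) u (inj₂ (here refl))  | yes x-dom = greedy-dominates prev xs u (inj₁ x-dom)
  greedy-dominates prev (x ∷ xs) u (inj₂ (there u∈xs)) | yes _     = greedy-dominates prev xs u (inj₂ u∈xs)
  greedy-dominates prev (x ∷ xs) u target              | no  _     =
    subst (λ S → Dominates S u) (++-assoc prev [ x ] _) (greedy-dominates (prev ++ [ x ]) xs u (step target))
    where
    step : Dominates prev u ⊎ u ∈ x ∷ xs → Dominates (prev ++ [ x ]) u ⊎ u ∈ xs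
    step (inj₁ dom)          = inj₁ (++⁺ˡ dom)
    step (inj₂ (here refl))  = inj₁ (∈⇒dominates (∈-++⁺ʳ prev (here refl)))
    step (inj₂ (there u∈xs)) = inj₂ u∈xs

  legal-extends-to-legalDominating : ∀ T → LegalFrom G [] T → ∃ λ C → LegalDominating G (T ++ C)
  legal-extends-to-legalDominating T legal =
    C , (proj₂ (legalFrom⇒fresh×unique [] (T ++ C) legal-T++C) , legal-T++C)
      , (λ u → greedy-dominates T (allFin n) u (inj₂ (∈-allFin u)))
    where
    C : List (Fin n)
    C = greedy T (allFin n)
    legal-T++C : LegalFrom G [] (T ++ C)
    legal-T++C = legalFrom-++ [] T legal (greedy-legal T (allFin n))

module EdgeEdit {n : ℕ} (H H' : Graph n) (es : List (Fin n × Fin n))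
  (edited : ∀ x u → adj H x u ≢ adj H' x u → (x , u) ∈ es ⊎ (u , x) ∈ es) where

  survivors : List (Fin n) → List (Fin n) → List (Fin n)
  survivors prev [] = []
  survivors prev (v ∷ vs) with footprints? H' prev v
  ... | yes _ = v ∷ survivors (prev ++ [ v ]) vs
  ... | no  _ = survivors (prev ++ [ v ]) vs

  survivors-legal : ∀ prev kept vs → kept ⊆ prev → LegalFrom H' kept (survivors prev vs)
  survivors-legal prev kept [] _ = tt
  survivors-legal prev kept (v ∷ vs) kept⊆prev with footprints? H' prev v
  ... | yes (u , v∋u , unseen) =
    (u , v∋u , All.tabulate (λ w∈kept → All.lookup unseen (kept⊆prev w∈kept)))
    , survivors-legal (prev ++ [ v ]) (kept ++ [ v ]) vs kept+v⊆prev+v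
    where
    kept+v⊆prev+v : kept ++ [ v ] ⊆ prev ++ [ v ]
    kept+v⊆prev+v w∈ with ∈-++⁻ kept w∈
    ... | inj₁ w∈kept = ∈-++⁺ˡ (kept⊆prev w∈kept)
    ... | inj₂ w≡v    = ∈-++⁺ʳ prev w≡v
  ... | no _ = survivors-legal (prev ++ [ v ]) kept vs (λ w∈kept → ∈-++⁺ˡ (kept⊆prev w∈kept))

  lost-footprint⇒edited-edge : ∀ prev v u → ¬ Footprints H' prev v → InN H v u →
    All (λ w → ¬ InN H w u) prev → ∃ λ x → x ∈ prev ++ [ v ] × adj H x u ≢ adj H' x u
  lost-footprint⇒edited-edge prev v u no-fp v∋u unseen with inN? H' v u
  ... | no v∌'u = v , ∈-++⁺ʳ prev (here refl) , differs v∋u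
    where
    differs : InN H v u → adj H v u ≢ adj H' v u
    differs (inj₁ u≡v) _   = v∌'u (inj₁ u≡v)
    differs (inj₂ vu) same = v∌'u (inj₂ (trans (sym same) vu))
  ... | yes v∋'u with dominates? H' prev u
  ...   | no undominated' = ⊥-elim (no-fp (u , v∋'u , ¬Any⇒All¬ prev undominated'))
  ...   | yes dominated' with find dominated'
  ...     | w , w∈prev , w∋'u = w , ∈-++⁺ˡ w∈prev , differs (All.lookup unseen w∈prev) w∋'u
    where
    differs : ¬ InN H w u → InN H' w u → adj H w u ≢ adj H' w u
    differs w∌u (inj₁ u≡w) _    = w∌u (inj₁ u≡w)
    differs w∌u (inj₂ wu)  same = w∌u (inj₂ (trans same wu))

  Covered : List (Fin n) → Fin n × Fin n → Set
  Covered S (x , y) = Dominates H S x × Dominates H S y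

  covered-++ : ∀ S T e → Covered S e → Covered (S ++ T) e
  covered-++ S T e (x-dom , y-dom) = ++⁺ˡ x-dom , ++⁺ˡ y-dom

  chargeable-edge : ∀ prev S x u → Dominates H S x → Dominates H S u → ¬ Dominates H prev u →
    (x , u) ∈ es ⊎ (u , x) ∈ es → ∃ λ e → e ∈ es × Covered S e × ¬ Covered prev e
  chargeable-edge prev S x u x-dom u-dom u-new (inj₁ xu∈es) = _ , xu∈es , (x-dom , u-dom) , u-new ∘ proj₂
  chargeable-edge prev S x u x-dom u-dom u-new (inj₂ ux∈es) = _ , ux∈es , (u-dom , x-dom) , u-new ∘ proj₁

  dropped-charged : ∀ prev vs → LegalFrom H prev vs →
    ∃ λ U → Unique U × All (_∈ es) U × All (λ e → ¬ Covered prev e) U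
          × length vs ≤ length (survivors prev vs) + length U
  dropped-charged prev [] _ = [] , [] , [] , [] , z≤n
  dropped-charged prev (v ∷ vs) ((u , v∋u , unseen) , legal) with footprints? H' prev v
  ... | yes _ with dropped-charged (prev ++ [ v ]) vs legal
  ...   | U , uniq , U⊆es , uncovered , len =
    U , uniq , U⊆es , All.map (λ {e} ¬cov cov → ¬cov (covered-++ prev [ v ] e cov)) uncovered , s≤s len
  dropped-charged prev (v ∷ vs) ((u , v∋u , unseen) , legal) | no no-fp
    with lost-footprint⇒edited-edge prev v u no-fp v∋u unseen
  ... | x , x∈prev+v , differs
    with chargeable-edge prev (prev ++ [ v ]) x u (∈⇒dominates H x∈prev+v) (++⁺ʳ prev (here v∋u))
           (All¬⇒¬Any unseen) (edited x u differs)
       | dropped-charged (prev ++ [ v ]) vs legal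
  ... | e , e∈es , e-covered , e-uncovered | U , uniq , U⊆es , uncovered , len =
    e ∷ U , All.map (λ ¬cov e≡e′ → ¬cov (subst (Covered (prev ++ [ v ])) e≡e′ e-covered)) uncovered ∷ uniq
    , e∈es ∷ U⊆es
    , e-uncovered ∷ All.map (λ {e′} ¬cov cov → ¬cov (covered-++ prev [ v ] e′ cov)) uncovered
    , ≤-trans (s≤s len) (≤-reflexive (sym (+-suc _ (length U))))

  legal⇒legalDominating-after-edit : ∀ S → LegalFrom H [] S →
    ∃ λ T → LegalDominating H' T × length S ≤ length T + length es
  legal⇒legalDominating-after-edit S legal
    with dropped-charged [] S legal
       | legal-extends-to-legalDominating H' (survivors [] S) (survivors-legal [] [] S (λ ()))
  ... | U , uniq , U⊆es , _ , len | C , legalDom =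
    survivors [] S ++ C , legalDom
    , ≤-trans len (+-mono-≤ (length-++-≤ˡ (survivors [] S)) (unique-⊆⇒length-≤ uniq U⊆es))

  grundy-≤-grundy+edits : ∀ {m m'} → IsGrundyDom H m → IsGrundyDom H' m' → m ≤ m' + length es
  grundy-≤-grundy+edits ((S , ((_ , legal) , _) , refl) , _) (_ , maximal)
    with legal⇒legalDominating-after-edit S legal
  ... | T , legalDom , len = ≤-trans len (+-monoˡ-≤ (length es) (maximal T legalDom))

differing-bools : ∀ {a b : Bool} → a ≢ b → (a ≡ true × b ≢ true) ⊎ (a ≢ true × b ≡ true)
differing-bools {true}  {true}  a≢b = ⊥-elim (a≢b refl)
differing-bools {true}  {false} _   = inj₁ (refl , λ ())
differing-bools {false} {true}  _   = inj₂ ((λ ()) , refl)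
differing-bools {false} {false} a≢b = ⊥-elim (a≢b refl)

addsEdges⇒edited : ∀ {n} {G G' : Graph n} {k} ((es , _) : AddsEdges G G' k) →
  ∀ x u → adj G x u ≢ adj G' x u → (x , u) ∈ es ⊎ (u , x) ∈ es
addsEdges⇒edited (es , _ , _ , _ , edges') x u differs with differing-bools differs
... | inj₁ (xu∈G , xu∉G') = ⊥-elim (xu∉G' (Equivalence.from (edges' x u) (inj₁ xu∈G)))
... | inj₂ (xu∉G , xu∈G') with Equivalence.to (edges' x u) xu∈G'
...   | inj₁ xu∈G = ⊥-elim (xu∉G xu∈G)
...   | inj₂ added = added

corollary2p2 : ∀ {n} (G G' : Graph n) (k m m' : ℕ) →
    AddsEdges G G' k → IsGrundyDom G m → IsGrundyDom G' m' →
    (m ≤ m' + k) × (m' ≤ m + k)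
corollary2p2 G G' k m m' adds@(es , length-es≡k , _) grundy grundy' =
  subst (λ l → m ≤ m' + l) length-es≡k (EdgeEdit.grundy-≤-grundy+edits G G' es edited grundy grundy')
  , subst (λ l → m' ≤ m + l) length-es≡k
      (EdgeEdit.grundy-≤-grundy+edits G' G es (λ x u → edited x u ∘ (_∘ sym)) grundy' grundy)
  where
  edited : ∀ x u → adj G x u ≢ adj G' x u → (x , u) ∈ es ⊎ (u , x) ∈ es
  edited = addsEdges⇒edited {G = G} {G'} adds
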